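{- Let $C_1,C_2$ be two distinct $k$-SAT clauses on the same set of $k$ variables. Then the $2$-blowup of the formula $\{C_1,C_2\}$ is not minimal.
   Context: A clause is a conjunction of $k$ literals ($x$ or $\overline x$) on $k$ distinct variables; a formula is a set of clauses. A formula $G$ is minimal if for each clause $C\in G$ there is a truth assignment satisfying $C$ and no other clause of $G$. The $2$-blowup $G[2]$ is obtained by replacing each variable $x$ by two duplicates $x,x'$ and each clause by all clauses obtained by choosing, for each of its variables, one of its two duplicates (keeping the sign of each literal). -}

module Defs where

open import Data.Nat using (ℕ; _+_; _*_)
open import Data.Bool using (Bool)
open import Data.Product using (_×_; _,_; proj₁; ∃)
open import Data.List using (List; []; _∷_; map; concatMap; length)
open import Data.List.Relation.Unary.All using (All)
open import Data.List.Relation.Unary.Unique.Propositional using (Unique)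
open import Data.List.Membership.Propositional using (_∈_)
open import Function.Bundles using (_⇔_)
open import Relation.Binary.PropositionalEquality using (_≡_)
open import Relation.Nullary using (¬_)

-- Variables are natural numbers; a literal is a variable together with a sign
-- (true = positive literal x, false = negated literal x̄).
Var : Set
Var = ℕ

Lit : Set
Lit = Var × Bool

-- A clause (a conjunction of literals) is represented by a list of literals.
Clause : Set
Clause = List Lit

vars : Clause → List Var
vars C = map proj₁ C

IsClause : ℕ → Clause → Set
IsClause k C = length C ≡ k × Unique (vars C)

_≈C_ : Clause → Clause → Set
C ≈C D = ∀ (l : Lit) → (l ∈ C) ⇔ (l ∈ D)

Formula : Set
Formula = List Clause

Assignment : Set
Assignment = Var → Bool

Sat : Assignment → Clause → Set
Sat α C = All (λ l → α (proj₁ l) ≡ Data.Product.proj₂ l) C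

Minimal : Formula → Set
Minimal G = ∀ C → C ∈ G →
  ∃ λ (α : Assignment) → Sat α C × (∀ D → D ∈ G → ¬ (D ≈C C) → ¬ Sat α D)

-- 2-blowup: variable x has duplicates 2x and 2x+1.
dup₀ dup₁ : Var → Var
dup₀ x = 2 * x
dup₁ x = 2 * x + 1

blowupClause : Clause → List Clause
blowupClause [] = [] ∷ []
blowupClause ((x , s) ∷ C) =
  concatMap (λ D → ((dup₀ x , s) ∷ D) ∷ ((dup₁ x , s) ∷ D) ∷ []) (blowupClause C)

blowup : Formula → Formula
blowup G = concatMap blowupClause G

-- Let α witness minimality for the clause D that uses only the first copies
-- x of the variables of C₁.  If every literal of C₂ is satisfied by α on one
-- of its two copies, some clause of the blowup of C₂ is satisfied by α; it
-- differs from D because C₁ and C₂ differ.  Otherwise some literal of C₂ on a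
-- variable x is false on both copies; since D forces x to agree with its
-- literal in C₁, so does x', and D with x replaced by x' is a second clause of
-- the blowup satisfied by α.
module Submission where

open import Defs
open import Data.Nat using (ℕ; _*_)
open import Data.Nat.Properties using (*-cancelˡ-≡; +-cancelʳ-≡; +-comm; even≢odd)
open import Data.Bool using (Bool; true; false; not; if_then_else_)
open import Data.Bool.Properties using (_≟_; ¬-not; not-¬)
open import Data.Product using (_×_; _,_; proj₁; proj₂)
open import Data.Sum using (_⊎_; inj₁; inj₂)
open import Data.Empty using (⊥-elim)
open import Data.List using ([]; _∷_; map)
open import Data.List.Relation.Unary.All as All using (All; all?)
open import Data.List.Relation.Unary.All.Properties using (map⁺; map⁻; ¬All⇒Any¬)
open import Data.List.Relation.Unary.Any as Any using (here; there)
open import Data.List.Relation.Binary.Subset.Propositional using (_⊆_)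
open import Data.List.Membership.Propositional using (_∈_; _∉_; find)
open import Data.List.Membership.Propositional.Properties using (∈-map⁺; ∈-map⁻; ∈-concatMap⁺)
open import Function using (_∘_; const)
open import Function.Bundles using (_⇔_; mk⇔; Equivalence)
open import Relation.Nullary using (¬_; yes; no; does)
open import Relation.Nullary.Decidable using (_⊎-dec_)
open import Relation.Unary using (Decidable)
open import Relation.Binary.PropositionalEquality using (_≡_; _≢_; refl; sym; trans; cong)

dup : Bool → Var → Var
dup false = dup₀
dup true  = dup₁

dup-injective : ∀ b b′ x y → dup b x ≡ dup b′ y → b ≡ b′ × x ≡ y
dup-injective false false x y e = refl , *-cancelˡ-≡ x y 2 e
dup-injective true  true  x y e = refl , *-cancelˡ-≡ x y 2 (+-cancelʳ-≡ 1 (2 * x) (2 * y) e)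
dup-injective false true  x y e = ⊥-elim (even≢odd x y (trans e (+-comm (2 * y) 1)))
dup-injective true  false x y e = ⊥-elim (even≢odd y x (trans (sym e) (+-comm (2 * x) 1)))

dupLit : (Lit → Bool) → Lit → Lit
dupLit c l = dup (c l) (proj₁ l) , proj₂ l

dupClause : (Lit → Bool) → Clause → Clause
dupClause c = map (dupLit c)

dupLit-injective : ∀ c c′ {l l′} → dupLit c l ≡ dupLit c′ l′ → l ≡ l′ × c l ≡ c′ l′
dupLit-injective c c′ {x , s} {y , t} e
  with dup-injective (c (x , s)) (c′ (y , t)) x y (cong proj₁ e) | cong proj₂ e
... | c≡c′ , refl | refl = refl , c≡c′

dupClause∈blowupClause : ∀ c C → dupClause c C ∈ blowupClause C
dupClause∈blowupClause c []            = here refl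
dupClause∈blowupClause c ((x , s) ∷ C) =
  ∈-concatMap⁺ _ (Any.map (λ { refl → extend (c (x , s)) }) (dupClause∈blowupClause c C))
  where
  extend : ∀ b → (dup b x , s) ∷ dupClause c C ∈
                 ((dup₀ x , s) ∷ dupClause c C) ∷ ((dup₁ x , s) ∷ dupClause c C) ∷ []
  extend false = here refl
  extend true  = there (here refl)

dupClause∈blowup : ∀ c {C} G → C ∈ G → dupClause c C ∈ blowup G
dupClause∈blowup c G C∈G =
  ∈-concatMap⁺ blowupClause {xs = G} (Any.map (λ { refl → dupClause∈blowupClause c _ }) C∈G)

dupClause-⊆⁻ : ∀ c c′ {C C′} → dupClause c C ⊆ dupClause c′ C′ → C ⊆ C′
dupClause-⊆⁻ c c′ sub l∈C with ∈-map⁻ (dupLit c′) (sub (∈-map⁺ (dupLit c) l∈C))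
... | l′ , l′∈C′ , e with dupLit-injective c c′ e
... | refl , _ = l′∈C′

dupClause-≈C⁻ : ∀ c c′ {C C′} → dupClause c C ≈C dupClause c′ C′ → C′ ≈C C
dupClause-≈C⁻ c c′ eq l =
  mk⇔ (dupClause-⊆⁻ c′ c (Equivalence.from (eq _))) (dupClause-⊆⁻ c c′ (Equivalence.to (eq _)))

dupLit∉dupClause : ∀ c c′ {l C} → c l ≢ c′ l → dupLit c l ∉ dupClause c′ C
dupLit∉dupClause c c′ cl≢c′l m with ∈-map⁻ (dupLit c′) m
... | l′ , _ , e with dupLit-injective c c′ e
... | refl , cl≡c′l = cl≢c′l cl≡c′l

SatCopy : Assignment → Bool → Lit → Set
SatCopy α b l = α (dup b (proj₁ l)) ≡ proj₂ l

Covered : Assignment → Lit → Set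
Covered α l = SatCopy α false l ⊎ SatCopy α true l

covered? : ∀ α → Decidable (Covered α)
covered? α (x , s) = (α (dup₀ x) ≟ s) ⊎-dec (α (dup₁ x) ≟ s)

uncovered-copies-agree : ∀ α {x s} → ¬ Covered α (x , s) → α (dup₁ x) ≡ α (dup₀ x)
uncovered-copies-agree α ¬cov = trans (¬-not (¬cov ∘ inj₂)) (sym (¬-not (¬cov ∘ inj₁)))

prefer : Bool → Assignment → Lit → Bool
prefer b α (x , s) = if does (α (dup b x) ≟ s) then b else not b

prefer-self : ∀ b α l → SatCopy α b l → prefer b α l ≡ b
prefer-self b α (x , s) sat with α (dup b x) ≟ s
... | yes _   = refl
... | no ¬sat = ⊥-elim (¬sat sat)

prefer-sat : ∀ b α l → Covered α l → SatCopy α (prefer b α l) l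
prefer-sat b α (x , s) cov with α (dup b x) ≟ s
... | yes sat = sat
... | no ¬sat = other b cov ¬sat
  where
  other : ∀ b → Covered α (x , s) → α (dup b x) ≢ s → α (dup (not b) x) ≡ s
  other false (inj₁ sat) ¬sat = ⊥-elim (¬sat sat)
  other false (inj₂ sat) _    = sat
  other true  (inj₁ sat) _    = sat
  other true  (inj₂ sat) ¬sat = ⊥-elim (¬sat sat)

Sat-dupClause-prefer : ∀ b α {C} → All (Covered α) C → Sat α (dupClause (prefer b α) C)
Sat-dupClause-prefer b α cov = map⁺ (All.map (prefer-sat b α _) cov)

lemma4p1 : (k : ℕ) (C₁ C₂ : Clause) → IsClause k C₁ → IsClause k C₂ →
    (∀ x → (x ∈ vars C₁) ⇔ (x ∈ vars C₂)) → ¬ (C₁ ≈C C₂) →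
    ¬ Minimal (blowup (C₁ ∷ C₂ ∷ []))
-- The argument never uses that the clauses have k literals on distinct variables.
lemma4p1 _ C₁ C₂ _ _ sameVars C₁≉C₂ minimal
  with minimal (dupClause (const false) C₁)
               (dupClause∈blowup (const false) (C₁ ∷ C₂ ∷ []) (here refl))
... | α , satD , onlyD with all? (covered? α) C₂
... | yes cov =
  onlyD (dupClause (prefer false α) C₂)
        (dupClause∈blowup (prefer false α) (C₁ ∷ C₂ ∷ []) (there (here refl)))
        (C₁≉C₂ ∘ dupClause-≈C⁻ (prefer false α) (const false))
        (Sat-dupClause-prefer false α cov)
... | no ¬cov with find (¬All⇒Any¬ (covered? α) C₂ ¬cov)
... | (x , s) , x∈C₂ , uncov
  with ∈-map⁻ proj₁ (Equivalence.from (sameVars x) (∈-map⁺ proj₁ x∈C₂))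
... | l , l∈C₁ , refl =
  onlyD (dupClause (prefer true α) C₁)
        (dupClause∈blowup (prefer true α) (C₁ ∷ C₂ ∷ []) (here refl))
        differs
        (Sat-dupClause-prefer true α (All.map inj₁ (map⁻ satD)))
  where
  satCopy₁ : SatCopy α true l
  satCopy₁ = trans (uncovered-copies-agree α {proj₁ l} {s} uncov) (All.lookup (map⁻ satD) l∈C₁)

  differs : ¬ (dupClause (prefer true α) C₁ ≈C dupClause (const false) C₁)
  differs eq = dupLit∉dupClause (prefer true α) (const false) {l} {C₁}
    (not-¬ (prefer-self true α l satCopy₁))
    (Equivalence.to (eq (dupLit (prefer true α) l)) (∈-map⁺ (dupLit (prefer true α)) l∈C₁))
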